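{- Let $I$ be a finite set of positive integers, $r \geq 0$, and let $A, B \subseteq H_r(I)$. Then $|A+B| \geq 9^{ -r}|A||B|$.
   Context: $\mathbb{F}_2^I$ is the vector space of tuples $(x_i)_{i\in I}$ over $\mathbb{F}_2$. The Hamming norm $\|x\|$ is the number of $i$ with $x_i=1$, and $H_r(I):=\{x\in\mathbb{F}_2^I: \|x\|\le r\}$. $A+B=\{a+b:a\in A,b\in B\}$. -}

module Defs where

open import Data.Bool using (Bool; true; false; _xor_)
open import Data.Bool.Properties using () renaming (_≟_ to _≟ᵇ_)
open import Data.Nat using (ℕ; zero; suc; _≤_)
open import Data.Vec using (Vec; []; _∷_; zipWith)
open import Data.Vec.Properties using (≡-dec)
open import Data.List using (List; length; deduplicate; cartesianProductWith)
open import Data.List.Relation.Unary.All using (All)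
open import Relation.Binary.PropositionalEquality using (_≡_)
open import Relation.Binary.Definitions using (DecidableEquality)

-- 𝔽₂ is modelled by Bool, with addition = xor.
-- 𝔽₂^I for a finite index set I with |I| = n is modelled by Vec Bool n.
F2^ : ℕ → Set
F2^ n = Vec Bool n

_⊕_ : ∀ {n} → F2^ n → F2^ n → F2^ n
_⊕_ = zipWith _xor_

‖_‖ : ∀ {n} → F2^ n → ℕ
‖ [] ‖ = zero
‖ true ∷ v ‖ = suc ‖ v ‖
‖ false ∷ v ‖ = ‖ v ‖

_≟v_ : ∀ {n} → DecidableEquality (F2^ n)
_≟v_ = ≡-dec _≟ᵇ_

-- A finite subset of 𝔽₂^n is given as a duplicate-free list (see Unique in the statement).
-- A ⊆ H_r : every element has Hamming norm ≤ r
⊆H : ∀ {n} → ℕ → List (F2^ n) → Set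
⊆H r A = All (λ x → ‖ x ‖ ≤ r) A

sumset : ∀ {n} → List (F2^ n) → List (F2^ n) → List (F2^ n)
sumset A B = deduplicate _≟v_ (cartesianProductWith _⊕_ A B)

{-# OPTIONS --safe #-}
-- Prove the sharper |A| |B| ≤ 3^r 3^s |A + B| for A ⊆ H_r, B ⊆ H_s by induction on the dimension.
-- Split A and B by their first coordinate into A₀, A₁ and B₀, B₁, with A₁ ⊆ H_(r-1) and B₁ ⊆ H_(s-1)
-- after deleting that coordinate; then Aᵢ + Bⱼ embeds into the slice i+j of A + B, so the induction
-- hypothesis bounds each of the four products aᵢ bⱼ of slice sizes. Since a₀b₀ · a₁b₁ = a₀b₁ · a₁b₀,
-- one of the two diagonal products is at most an off-diagonal one, and the four bounds add up to
-- 3 · 3 times the old constant. When r = 0 (or s = 0) the set is empty or {0}, and A + B contains a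
-- translate of the other set.
module Submission where

open import Defs
open import Data.Nat using (ℕ; _≤_; _*_; _^_)
open import Data.List using (List; length)
open import Data.List.Relation.Unary.Unique.Propositional using (Unique)

open import Data.Bool using (Bool; true; false; _xor_)
open import Data.Bool.Properties using (not-injective; xor-comm) renaming (_≟_ to _≟ᵇ_)
open import Data.Nat using (zero; suc; _+_; z≤n; s≤s⁻¹)
open import Data.Nat.Properties
open import Data.Nat.Tactic.RingSolver using (solve-∀)
open import Data.Vec using ([]; _∷_; replicate)
open import Data.Vec.Properties using (∷-injectiveˡ; ∷-injectiveʳ; zipWith-comm)
open import Data.List using ([]; _∷_; [_]; map; filter; cartesianProductWith)
open import Data.List.Properties using (length-map; filter-notAll)
open import Data.List.Relation.Unary.All as All using (All; []; _∷_)
open import Data.List.Relation.Unary.AllPairs using ([]; _∷_)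
import Data.List.Relation.Unary.Any as Any
open import Data.List.Relation.Unary.Any using (here; there)
open import Data.List.Relation.Unary.Unique.Propositional.Properties using (map⁺)
open import Data.List.Relation.Unary.Unique.DecPropositional.Properties using (deduplicate-!)
open import Data.List.Membership.Propositional using (_∈_)
open import Data.List.Membership.Propositional.Properties
  using (∈-filter⁺; ∈-map⁻; ∈-deduplicate⁺; ∈-deduplicate⁻; ∈-cartesianProductWith⁺; ∈-cartesianProductWith⁻)
open import Data.List.Relation.Binary.Subset.Propositional using (_⊆_)
open import Data.Product using (_×_; _,_; ∃₂)
open import Data.Sum using (_⊎_; inj₁; inj₂)
open import Function using (id; _∘_)
open import Function.Definitions using (Injective)
open import Relation.Unary using (Decidable)
open import Relation.Nullary using (¬?; yes; no; contradiction)
open import Relation.Binary.Definitions using (DecidableEquality)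
open import Relation.Binary.PropositionalEquality using (_≡_; _≢_; refl; sym; trans; cong; cong₂; module ≡-Reasoning)

private variable
  n : ℕ

module _ {X : Set} (_≟_ : DecidableEquality X) where

  length-mono-⊆ : {xs ys : List X} → Unique xs → xs ⊆ ys → length xs ≤ length ys
  length-mono-⊆ {[]} _ _ = z≤n
  length-mono-⊆ {x ∷ xs} {ys} (x∉xs ∷ !xs) xs⊆ys = begin-strict
    length xs               ≤⟨ length-mono-⊆ !xs xs⊆ys-x ⟩
    length (filter x≢? ys)  <⟨ filter-notAll x≢? ys (Any.map (λ x≡y x≢y → x≢y x≡y) (xs⊆ys (here refl))) ⟩
    length ys               ∎
    where
    open ≤-Reasoning
    x≢? : Decidable (x ≢_)
    x≢? y = ¬? (x ≟ y)
    xs⊆ys-x : xs ⊆ filter x≢? ys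
    xs⊆ys-x z∈xs = ∈-filter⁺ x≢? (xs⊆ys (there z∈xs)) (All.lookup x∉xs z∈xs)

  length-mono-↣ : {W : Set} {f : W → X} → Injective _≡_ _≡_ f →
    {ws : List W} {ys : List X} → Unique ws → (∀ {w} → w ∈ ws → f w ∈ ys) → length ws ≤ length ys
  length-mono-↣ {f = f} f-inj {ws} {ys} !ws f[ws]⊆ys = begin
    length ws          ≡⟨ length-map f ws ⟨
    length (map f ws)  ≤⟨ length-mono-⊆ (map⁺ f-inj !ws) image⊆ys ⟩
    length ys          ∎
    where
    open ≤-Reasoning
    image⊆ys : map f ws ⊆ ys
    image⊆ys v∈image with ∈-map⁻ f v∈image
    ... | w , w∈ws , refl = f[ws]⊆ys w∈ws

⊕-cancelˡ : (a : F2^ n) {b c : F2^ n} → a ⊕ b ≡ a ⊕ c → b ≡ c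
⊕-cancelˡ [] {[]} {[]} _ = refl
⊕-cancelˡ (x ∷ a) {_ ∷ _} {_ ∷ _} eq =
  cong₂ _∷_ (xor-cancelˡ x (∷-injectiveˡ eq)) (⊕-cancelˡ a (∷-injectiveʳ eq))
  where
  xor-cancelˡ : ∀ x {y z} → x xor y ≡ x xor z → y ≡ z
  xor-cancelˡ false = id
  xor-cancelˡ true  = not-injective

⊕-comm : (a b : F2^ n) → a ⊕ b ≡ b ⊕ a
⊕-comm = zipWith-comm xor-comm

⊕-cancelʳ : {a b : F2^ n} (c : F2^ n) → a ⊕ c ≡ b ⊕ c → a ≡ b
⊕-cancelʳ {a = a} {b} c eq = ⊕-cancelˡ c (trans (⊕-comm c a) (trans eq (⊕-comm b c)))

‖v‖≤0⇒v≡0 : (v : F2^ n) → ‖ v ‖ ≤ 0 → v ≡ replicate n false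
‖v‖≤0⇒v≡0 []          _ = refl
‖v‖≤0⇒v≡0 (false ∷ v) h = cong (false ∷_) (‖v‖≤0⇒v≡0 v h)

Unique∧⊆H0⇒length≤1 : {A : List (F2^ n)} → Unique A → ⊆H 0 A → length A ≤ 1
Unique∧⊆H0⇒length≤1 {n} !A hA =
  length-mono-⊆ _≟v_ {ys = [ replicate n false ]} !A (λ a∈A → here (‖v‖≤0⇒v≡0 _ (All.lookup hA a∈A)))

∈-sumset⁻ : (A B : List (F2^ n)) {v : F2^ n} → v ∈ sumset A B → ∃₂ λ a b → a ∈ A × b ∈ B × v ≡ a ⊕ b
∈-sumset⁻ A B v∈A+B =
  ∈-cartesianProductWith⁻ _⊕_ A B (∈-deduplicate⁻ _≟v_ (cartesianProductWith _⊕_ A B) v∈A+B)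

sumset-unique : (A B : List (F2^ n)) → Unique (sumset A B)
sumset-unique A B = deduplicate-! _≟v_ (cartesianProductWith _⊕_ A B)

module _ {A B : List (F2^ n)} where

  ∈-sumset⁺ : ∀ {a b} → a ∈ A → b ∈ B → a ⊕ b ∈ sumset A B
  ∈-sumset⁺ a∈A b∈B = ∈-deduplicate⁺ _≟v_ (∈-cartesianProductWith⁺ _⊕_ a∈A b∈B)

  length-≤-sumsetʳ : ∀ {a} → a ∈ A → Unique B → length B ≤ length (sumset A B)
  length-≤-sumsetʳ a∈A !B = length-mono-↣ _≟v_ (⊕-cancelˡ _) !B (∈-sumset⁺ a∈A)

  length-≤-sumsetˡ : ∀ {b} → b ∈ B → Unique A → length A ≤ length (sumset A B)
  length-≤-sumsetˡ b∈B !A = length-mono-↣ _≟v_ (⊕-cancelʳ _) !A (λ a∈A → ∈-sumset⁺ a∈A b∈B)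

slice : Bool → List (F2^ (suc n)) → List (F2^ n)
slice b [] = []
slice b ((c ∷ v) ∷ xs) with b ≟ᵇ c
... | yes _ = v ∷ slice b xs
... | no  _ = slice b xs

∈-slice⁺ : ∀ {b} {v : F2^ n} {xs} → b ∷ v ∈ xs → v ∈ slice b xs
∈-slice⁺ {b = b} {xs = (c ∷ w) ∷ xs} p with b ≟ᵇ c | p
... | yes _    | here refl = here refl
... | yes _    | there p′  = there (∈-slice⁺ p′)
... | no  b≢c  | here refl = contradiction refl b≢c
... | no  _    | there p′  = ∈-slice⁺ p′

∈-slice⁻ : ∀ b xs {v : F2^ n} → v ∈ slice b xs → b ∷ v ∈ xs
∈-slice⁻ b ((c ∷ w) ∷ xs) p with b ≟ᵇ c | p
... | yes refl | here refl = here refl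
... | yes refl | there p′  = there (∈-slice⁻ b xs p′)
... | no  _    | p′        = there (∈-slice⁻ b xs p′)

slice-All : ∀ {b} {P : F2^ (suc n) → Set} {xs} → All P xs → All (P ∘ (b ∷_)) (slice b xs)
slice-All [] = []
slice-All {b = b} {xs = (c ∷ v) ∷ xs} (px ∷ pxs) with b ≟ᵇ c
... | yes refl = px ∷ slice-All pxs
... | no  _    = slice-All pxs

slice-unique : ∀ {b} {xs : List (F2^ (suc n))} → Unique xs → Unique (slice b xs)
slice-unique [] = []
slice-unique {b = b} {xs = (c ∷ v) ∷ xs} (x∉xs ∷ !xs) with b ≟ᵇ c
... | yes refl = All.map (_∘ cong (b ∷_)) (slice-All x∉xs) ∷ slice-unique !xs
... | no  _    = slice-unique !xs

length-slices : (xs : List (F2^ (suc n))) →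
  length xs ≡ length (slice false xs) + length (slice true xs)
length-slices [] = refl
length-slices ((false ∷ v) ∷ xs) = cong suc (length-slices xs)
length-slices ((true ∷ v) ∷ xs) = trans (cong suc (length-slices xs)) (sym (+-suc _ _))

⊆H-slice-true : ∀ {r} {xs : List (F2^ (suc n))} → ⊆H (suc r) xs → ⊆H r (slice true xs)
⊆H-slice-true hxs = All.map s≤s⁻¹ (slice-All hxs)

length-sumset-slices : ∀ i j (A B : List (F2^ (suc n))) →
  length (sumset (slice i A) (slice j B)) ≤ length (slice (i xor j) (sumset A B))
length-sumset-slices i j A B = length-mono-⊆ _≟v_ (sumset-unique (slice i A) (slice j B)) sumset-slices⊆
  where
  sumset-slices⊆ : sumset (slice i A) (slice j B) ⊆ slice (i xor j) (sumset A B)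
  sumset-slices⊆ v∈ with ∈-sumset⁻ (slice i A) (slice j B) v∈
  ... | a , b , a∈Aᵢ , b∈Bⱼ , refl = ∈-slice⁺ (∈-sumset⁺ (∈-slice⁻ i A a∈Aᵢ) (∈-slice⁻ j B b∈Bⱼ))

sumset-bound-H0ˡ : {A B : List (F2^ n)} → Unique A → Unique B → ⊆H 0 A →
  length A * length B ≤ length (sumset A B)
sumset-bound-H0ˡ {A = []} _ _ _ = z≤n
sumset-bound-H0ˡ {A = A@(_ ∷ _)} {B} !A !B hA = begin
  length A * length B  ≤⟨ *-monoˡ-≤ (length B) (Unique∧⊆H0⇒length≤1 !A hA) ⟩
  1 * length B         ≡⟨ *-identityˡ (length B) ⟩
  length B             ≤⟨ length-≤-sumsetʳ {A = A} (here refl) !B ⟩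
  length (sumset A B)  ∎
  where open ≤-Reasoning

sumset-bound-H0ʳ : {A B : List (F2^ n)} → Unique A → Unique B → ⊆H 0 B →
  length A * length B ≤ length (sumset A B)
sumset-bound-H0ʳ {A = A} {B = []} _ _ _ = ≤-trans (≤-reflexive (*-zeroʳ (length A))) z≤n
sumset-bound-H0ʳ {A = A} {B@(_ ∷ _)} !A !B hB = begin
  length A * length B  ≤⟨ *-monoʳ-≤ (length A) (Unique∧⊆H0⇒length≤1 !B hB) ⟩
  length A * 1         ≡⟨ *-identityʳ (length A) ⟩
  length A             ≤⟨ length-≤-sumsetˡ {B = B} (here refl) !A ⟩
  length (sumset A B)  ∎
  where open ≤-Reasoning

diagonal-dominated : ∀ a₀ a₁ b₀ b₁ → a₁ * b₁ ≤ a₁ * b₀ ⊎ a₀ * b₀ ≤ a₀ * b₁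
diagonal-dominated a₀ a₁ b₀ b₁ with ≤-total b₁ b₀
... | inj₁ b₁≤b₀ = inj₁ (*-monoʳ-≤ a₁ b₁≤b₀)
... | inj₂ b₀≤b₁ = inj₂ (*-monoʳ-≤ a₀ b₀≤b₁)

product-bound : ∀ {a₀ a₁ b₀ b₁ p q} →
  a₀ * b₀ ≤ 9 * q → a₁ * b₁ ≤ q → a₀ * b₁ ≤ p → a₁ * b₀ ≤ p →
  (a₀ + a₁) * (b₀ + b₁) ≤ 9 * q + 3 * p
product-bound {a₀} {a₁} {b₀} {b₁} {p} {q} h₀₀ h₁₁ h₀₁ h₁₀ = begin
  (a₀ + a₁) * (b₀ + b₁)                       ≡⟨ expand a₀ a₁ b₀ b₁ ⟩
  (a₀ * b₀ + a₁ * b₁) + (a₀ * b₁ + a₁ * b₀)   ≤⟨ +-mono-≤ diagonal (+-mono-≤ h₀₁ h₁₀) ⟩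
  (9 * q + p) + (p + p)                       ≡⟨ collect q p ⟩
  9 * q + 3 * p                               ∎
  where
  open ≤-Reasoning
  expand : ∀ a₀ a₁ b₀ b₁ → (a₀ + a₁) * (b₀ + b₁) ≡ (a₀ * b₀ + a₁ * b₁) + (a₀ * b₁ + a₁ * b₀)
  expand = solve-∀
  collect : ∀ q p → (9 * q + p) + (p + p) ≡ 9 * q + 3 * p
  collect = solve-∀
  diagonal : a₀ * b₀ + a₁ * b₁ ≤ 9 * q + p
  diagonal with diagonal-dominated a₀ a₁ b₀ b₁
  ... | inj₁ d₁₁ = +-mono-≤ h₀₀ (≤-trans d₁₁ h₁₀)
  ... | inj₂ d₀₀ = begin
    a₀ * b₀ + a₁ * b₁  ≤⟨ +-mono-≤ (≤-trans d₀₀ h₀₁) h₁₁ ⟩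
    p + q              ≡⟨ +-comm p q ⟩
    q + p              ≤⟨ +-monoˡ-≤ p (m≤n*m q 9) ⟩
    9 * q + p          ∎

split-bound : ∀ R S {a₀ a₁ b₀ b₁ m₀ m₁} →
  a₀ * b₀ ≤ 3 * R * (3 * S) * m₀ → a₁ * b₁ ≤ R * S * m₀ →
  a₀ * b₁ ≤ 3 * R * S * m₁ → a₁ * b₀ ≤ R * (3 * S) * m₁ →
  (a₀ + a₁) * (b₀ + b₁) ≤ 3 * R * (3 * S) * (m₀ + m₁)
split-bound R S {a₀} {a₁} {b₀} {b₁} {m₀} {m₁} h₀₀ h₁₁ h₀₁ h₁₀ = begin
  (a₀ + a₁) * (b₀ + b₁)
    ≤⟨ product-bound {a₀} {a₁} {b₀} {b₁}
         (≤-trans h₀₀ (≤-reflexive (e₀₀ R S m₀))) h₁₁ h₀₁ (≤-trans h₁₀ (≤-reflexive (e₁₀ R S m₁))) ⟩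
  9 * (R * S * m₀) + 3 * (3 * R * S * m₁)
    ≡⟨ e R S m₀ m₁ ⟩
  3 * R * (3 * S) * (m₀ + m₁) ∎
  where
  open ≤-Reasoning
  e₀₀ : ∀ R S m₀ → 3 * R * (3 * S) * m₀ ≡ 9 * (R * S * m₀)
  e₀₀ = solve-∀
  e₁₀ : ∀ R S m₁ → R * (3 * S) * m₁ ≡ 3 * R * S * m₁
  e₁₀ = solve-∀
  e : ∀ R S m₀ m₁ → 9 * (R * S * m₀) + 3 * (3 * R * S * m₁) ≡ 3 * R * (3 * S) * (m₀ + m₁)
  e = solve-∀

≤-scale-3^ : ∀ r s {x y} → x ≤ y → x ≤ 3 ^ r * 3 ^ s * y
≤-scale-3^ r s {y = y} x≤y =
  ≤-trans x≤y (m≤n*m y (3 ^ r * 3 ^ s) {{m*n≢0 (3 ^ r) (3 ^ s) {{m^n≢0 3 r}} {{m^n≢0 3 s}}}})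

sumset-bound : ∀ n r s {A B : List (F2^ n)} → Unique A → Unique B → ⊆H r A → ⊆H s B →
  length A * length B ≤ 3 ^ r * 3 ^ s * length (sumset A B)
sumset-bound zero r s {A} !A !B _ _ =
  ≤-scale-3^ r s (sumset-bound-H0ˡ !A !B (All.universal (λ { [] → z≤n }) A))
sumset-bound (suc n) zero s !A !B hA _ = ≤-scale-3^ zero s (sumset-bound-H0ˡ !A !B hA)
sumset-bound (suc n) (suc r) zero !A !B _ hB = ≤-scale-3^ (suc r) zero (sumset-bound-H0ʳ !A !B hB)
sumset-bound (suc n) (suc r) (suc s) {A} {B} !A !B hA hB = begin
  length A * length B
    ≡⟨ cong₂ _*_ (length-slices A) (length-slices B) ⟩
  (length A₀ + length A₁) * (length B₀ + length B₁)
    ≤⟨ split-bound (3 ^ r) (3 ^ s) {length A₀} {length A₁} {length B₀} {length B₁}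
         (slice-bound false false (slice-All hA) (slice-All hB))
         (slice-bound true true (⊆H-slice-true hA) (⊆H-slice-true hB))
         (slice-bound false true (slice-All hA) (⊆H-slice-true hB))
         (slice-bound true false (⊆H-slice-true hA) (slice-All hB)) ⟩
  3 ^ suc r * 3 ^ suc s * (length (slice false (sumset A B)) + length (slice true (sumset A B)))
    ≡⟨ cong (3 ^ suc r * 3 ^ suc s *_) (length-slices (sumset A B)) ⟨
  3 ^ suc r * 3 ^ suc s * length (sumset A B) ∎
  where
  open ≤-Reasoning
  A₀ A₁ B₀ B₁ : List (F2^ n)
  A₀ = slice false A
  A₁ = slice true A
  B₀ = slice false B
  B₁ = slice true B
  slice-bound : ∀ i j {r′ s′} → ⊆H r′ (slice i A) → ⊆H s′ (slice j B) →
    length (slice i A) * length (slice j B) ≤ 3 ^ r′ * 3 ^ s′ * length (slice (i xor j) (sumset A B))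
  slice-bound i j {r′} {s′} hAᵢ hBⱼ =
    ≤-trans (sumset-bound n _ _ (slice-unique !A) (slice-unique !B) hAᵢ hBⱼ)
            (*-monoʳ-≤ (3 ^ r′ * 3 ^ s′) (length-sumset-slices i j A B))

9^n≡3^n*3^n : ∀ n → 9 ^ n ≡ 3 ^ n * 3 ^ n
9^n≡3^n*3^n n = begin
  9 ^ n                ≡⟨ ^-*-assoc 3 2 n ⟩
  3 ^ (n + (n + 0))    ≡⟨ ^-distribˡ-+-* 3 n (n + 0) ⟩
  3 ^ n * 3 ^ (n + 0)  ≡⟨ cong (λ k → 3 ^ n * 3 ^ k) (+-identityʳ n) ⟩
  3 ^ n * 3 ^ n        ∎
  where open ≡-Reasoning

proposition3p1 : (n r : ℕ) (A B : List (F2^ n)) →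
    Unique A → Unique B → ⊆H r A → ⊆H r B →
    length A * length B ≤ 9 ^ r * length (sumset A B)
proposition3p1 n r A B !A !B hA hB = begin
  length A * length B                  ≤⟨ sumset-bound n r r !A !B hA hB ⟩
  3 ^ r * 3 ^ r * length (sumset A B)  ≡⟨ cong (_* length (sumset A B)) (9^n≡3^n*3^n r) ⟨
  9 ^ r * length (sumset A B)          ∎
  where open ≤-Reasoning
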